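{- Let $G$ be a circulant graph $C_n(S)$. If $G$ is vertex decomposable, then $\mathrm{Shed}(G)$ is a dominating set of $G$.
   Context: For $n\ge 1$ and $S\subseteq\{1,\ldots,\lfloor n/2\rfloor\}$, the circulant graph $C_n(S)$ has vertex set $\{0,\ldots,n-1\}$ and edges $\{a,b\}$ with $|a-b|\in S$ or $n-|a-b|\in S$. All graphs are finite and simple. For a graph $G=(V,E)$ and $x\in V$, $G\setminus x$ is the graph obtained by deleting $x$ and its incident edges; $N(x)$ is the set of neighbours of $x$, $N[x]=N(x)\cup\{x\}$, and $G\setminus N[x]$ is obtained by deleting all vertices of $N[x]$ and their incident edges. A graph is well-covered if all its maximal independent sets have the same cardinality. A graph $G$ is vertex decomposable if $G$ is well-covered and either (i) $G$ has no edges (possibly no vertices), or (ii) there is a vertex $x$ such that both $G\setminus x$ and $G\setminus N[x]$ are vertex decomposable. For a vertex decomposable graph $G$, $\mathrm{Shed}(G)$ is the set of vertices $x$ such that $G\setminus x$ and $G\setminus N[x]$ are both vertex decomposable. A set $D\subseteq V$ is dominating if every vertex of $V\setminus D$ is adjacent to a vertex of $D$. -}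

module Defs where

open import Data.Nat using (ℕ; _≤_; _/_; ∣_-_∣; _∸_)
open import Data.Fin using (Fin; toℕ; _≟_)
open import Data.Fin.Subset using (Subset; _∈_; _∉_; _⊆_; ∣_∣; _─_; _-_; ⊤)
open import Data.Bool using (_∨_)
open import Data.Vec using (tabulate)
open import Data.List using (List)
open import Data.List.Relation.Unary.All using (All)
open import Data.List.Membership.Propositional as L using ()
open import Data.Product using (Σ; _×_; ∃; ∃-syntax)
open import Data.Sum using (_⊎_)
open import Data.Empty using (⊥)
open import Relation.Nullary using (¬_; Dec)
open import Relation.Nullary.Decidable using (⌊_⌋)
open import Relation.Binary.PropositionalEquality using (_≡_)
open import Relation.Nullary.Decidable using (_⊎-dec_)
open import Data.List.Membership.DecPropositional Data.Nat._≟_ using () renaming (_∈?_ to _ℕ∈?_)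
import Data.Nat

-- A finite graph on vertex set Fin m with decidable adjacency.
-- (Simplicity is guaranteed for circulants by construction; see below.)
record Graph (m : ℕ) : Set₁ where
  field
    Adj  : Fin m → Fin m → Set
    adj? : (x y : Fin m) → Dec (Adj x y)
open Graph public

dist : {n : ℕ} → Fin n → Fin n → ℕ
dist a b = absDiff (toℕ a) (toℕ b)
  where
  absDiff : ℕ → ℕ → ℕ
  absDiff = ∣_-_∣

CircAdj : (n : ℕ) → List ℕ → Fin n → Fin n → Set
CircAdj n S a b =
  (dist a b L.∈ S) ⊎ ((n ∸ dist a b) L.∈ S)

circAdj? : (n : ℕ) (S : List ℕ) (a b : Fin n) → Dec (CircAdj n S a b)
circAdj? n S a b =
  (dist a b ℕ∈? S) ⊎-dec ((n ∸ dist a b) ℕ∈? S)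

Circulant : (n : ℕ) → List ℕ → Graph n
Circulant n S = record { Adj = CircAdj n S ; adj? = circAdj? n S }

ValidConnSet : ℕ → List ℕ → Set
ValidConnSet n S = All (λ s → 1 ≤ s × s ≤ n / 2) S

module _ {m : ℕ} (G : Graph m) where

  closedNbhd : Fin m → Subset m
  closedNbhd x = tabulate (λ y → ⌊ y ≟ x ⌋ ∨ ⌊ adj? G x y ⌋)

  -- All graphs below are induced subgraphs G[U], U ⊆ V(G);
  -- G[U] \ x  is  G[U - x]  and  G[U] \ N[x]  is  G[U ─ N[x]].

  Independent : Subset m → Subset m → Set
  Independent U I = I ⊆ U × (∀ x y → x ∈ I → y ∈ I → ¬ Adj G x y)

  MaximalIndependent : Subset m → Subset m → Set
  MaximalIndependent U I =
    Independent U I × (∀ v → v ∈ U → v ∉ I → ∃[ u ] (u ∈ I × Adj G v u))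

  WellCovered : Subset m → Set
  WellCovered U = ∀ I J → MaximalIndependent U I → MaximalIndependent U J
                  → ∣ I ∣ ≡ ∣ J ∣

  NoEdges : Subset m → Set
  NoEdges U = ∀ x y → x ∈ U → y ∈ U → ¬ Adj G x y

  data VertexDecomposable (U : Subset m) : Set where
    vd-edgeless : WellCovered U → NoEdges U → VertexDecomposable U
    vd-shed     : WellCovered U → (x : Fin m) → x ∈ U
                → VertexDecomposable (U - x)
                → VertexDecomposable (U ─ closedNbhd x)
                → VertexDecomposable U

  InShed : Fin m → Set
  InShed x = VertexDecomposable (⊤ - x) × VertexDecomposable (⊤ ─ closedNbhd x)

  Dominating : (Fin m → Set) → Set
  Dominating D = ∀ v → ¬ D v → ∃[ u ] (D u × Adj G v u)

module Submission where

-- The idea is vertex transitivity: Shed(G) is invariant under every graph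
-- automorphism, and the rotation i ↦ i - 1 (mod n) of C_n(S) is an
-- automorphism whose orbit is the whole vertex set.  Hence Shed(C_n(S)) is
-- either empty or everything.  It is not empty when C_n(S) is vertex
-- decomposable: either the decomposition sheds some vertex x, which is then in
-- Shed by definition, or the graph has no edges and every induced subgraph is
-- vertex decomposable.  So Shed(G) = V(G), which is trivially dominating.

open import Defs
open import Data.Nat using (ℕ; _≤_)
open import Data.List using (List)
open import Data.Fin.Subset using (⊤)

import Data.Nat as ℕ
open import Data.Nat using (suc; _∸_; ∣_-_∣)
import Data.Nat.Properties as ℕP
import Data.Fin as Fin
open import Data.Fin using (Fin; toℕ; fromℕ; inject₁; lower₁) renaming (zero to fzero; suc to fsuc)
import Data.Fin.Properties as FinP
open import Data.Fin.Induction using (<-weakInduction; >-weakInduction)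
open import Data.Fin.Permutation using (Permutation; permutation; _⟨$⟩ʳ_; _⟨$⟩ˡ_; inverseˡ; inverseʳ)
open import Data.Fin.Subset using (Subset; _∈_; _∉_; _─_; ⁅_⁆; ∣_∣)
import Data.Fin.Subset.Properties as SubsetP
open import Data.Bool using (Bool; true; false; _∨_)
open import Data.Vec using (Vec; []; _∷_; lookup; tabulate; zipWith)
import Data.Vec.Properties as VecP
open import Data.Product using (_×_; _,_; ∃-syntax)
open import Data.Sum using (_⊎_; inj₁; inj₂)
open import Data.Empty using (⊥-elim)
open import Function using (_∘_; id; mk⇔)
open import Relation.Nullary using (¬_; Dec; yes; no; contradiction)
open import Relation.Nullary.Decidable using (⌊_⌋; isYes≗does; does-⇔)
open import Relation.Binary.PropositionalEquality
open import Data.List.Membership.Propositional as L using ()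
open import Algebra.Properties.CommutativeMonoid.Sum ℕP.+-0-commutativeMonoid
  using (sum; sum-permute; sum-cong-≗)

lookup-≡ : ∀ {n} {p q : Subset n} {i j : Fin n} →
           (i ∈ p → j ∈ q) → (j ∈ q → i ∈ p) → lookup p i ≡ lookup q j
lookup-≡ {p = p} {q} {i} {j} to from with lookup p i in pᵢ | lookup q j in qⱼ
... | true  | true  = refl
... | false | false = refl
... | true  | false =
  contradiction (trans (sym qⱼ) (VecP.[]=⇒lookup (to (VecP.lookup⇒[]= i p pᵢ)))) λ ()
... | false | true  =
  contradiction (trans (sym pᵢ) (VecP.[]=⇒lookup (from (VecP.lookup⇒[]= j q qⱼ)))) λ ()

lookup-zipWith-cong : ∀ {A B C : Set} {n} (f : A → B → C) {xs xs′ : Vec A n}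
                      {ys ys′ : Vec B n} {i j : Fin n} →
                      lookup xs i ≡ lookup xs′ j → lookup ys i ≡ lookup ys′ j →
                      lookup (zipWith f xs ys) i ≡ lookup (zipWith f xs′ ys′) j
lookup-zipWith-cong f {xs} {xs′} {ys} {ys′} {i} {j} x≡x′ y≡y′ = begin
  lookup (zipWith f xs ys) i     ≡⟨ VecP.lookup-zipWith f i xs ys ⟩
  f (lookup xs i) (lookup ys i)  ≡⟨ cong₂ f x≡x′ y≡y′ ⟩
  f (lookup xs′ j) (lookup ys′ j) ≡⟨ VecP.lookup-zipWith f j xs′ ys′ ⟨
  lookup (zipWith f xs′ ys′) j   ∎
  where open ≡-Reasoning

⌊⌋-⇔ : ∀ {P Q : Set} (p? : Dec P) (q? : Dec Q) → (P → Q) → (Q → P) → ⌊ p? ⌋ ≡ ⌊ q? ⌋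
⌊⌋-⇔ p? q? to from =
  trans (isYes≗does p?) (trans (does-⇔ (mk⇔ to from) p? q?) (sym (isYes≗does q?)))

indicator : Bool → ℕ
indicator true  = 1
indicator false = 0

∣∣≡sum : ∀ {n} (p : Subset n) → ∣ p ∣ ≡ sum (indicator ∘ lookup p)
∣∣≡sum []          = refl
∣∣≡sum (true  ∷ p) = cong suc (∣∣≡sum p)
∣∣≡sum (false ∷ p) = ∣∣≡sum p

∣∣-permute : ∀ {n} (π : Permutation n n) {p q : Subset n} →
             (∀ i → lookup q (π ⟨$⟩ʳ i) ≡ lookup p i) → ∣ p ∣ ≡ ∣ q ∣
∣∣-permute π {p} {q} q∘π≡p = begin
  ∣ p ∣                                ≡⟨ ∣∣≡sum p ⟩
  sum (indicator ∘ lookup p)            ≡⟨ sum-cong-≗ (cong indicator ∘ sym ∘ q∘π≡p) ⟩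
  sum (indicator ∘ lookup q ∘ (π ⟨$⟩ʳ_)) ≡⟨ sum-permute (indicator ∘ lookup q) π ⟨
  sum (indicator ∘ lookup q)            ≡⟨ ∣∣≡sum q ⟨
  ∣ q ∣                                ∎
  where open ≡-Reasoning

record Automorphism {m : ℕ} (G : Graph m) : Set where
  field
    perm      : Permutation m m
    preserves : ∀ {x y} → Adj G x y → Adj G (perm ⟨$⟩ʳ x) (perm ⟨$⟩ʳ y)
    reflects  : ∀ {x y} → Adj G (perm ⟨$⟩ʳ x) (perm ⟨$⟩ʳ y) → Adj G x y

-- The image under σ of an induced subgraph G[U] is isomorphic to it, so
-- independence, well-coveredness and vertex decomposability transfer along σ.
module AutomorphismAction {m : ℕ} {G : Graph m} (σ : Automorphism G) where
  open Automorphism σ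

  infix 4 _↦_

  σ· σ⁻¹ : Fin m → Fin m
  σ· x  = perm ⟨$⟩ʳ x
  σ⁻¹ y = perm ⟨$⟩ˡ y

  σσ⁻¹ : ∀ y → σ· (σ⁻¹ y) ≡ y
  σσ⁻¹ y = inverseʳ perm

  -- V is the image of U under σ (a record, so that U and V are inferable).
  record _↦_ (U V : Subset m) : Set where
    constructor image
    field lookup-image : ∀ i → lookup V (σ· i) ≡ lookup U i

  ↦-∈ : ∀ {U V x} → U ↦ V → x ∈ U → σ· x ∈ V
  ↦-∈ {x = x} (image U↦V) x∈U = VecP.lookup⇒[]= _ _ (trans (U↦V x) (VecP.[]=⇒lookup x∈U))

  ↦-∈⁻ : ∀ {U V x} → U ↦ V → σ· x ∈ V → x ∈ U
  ↦-∈⁻ {x = x} (image U↦V) σx∈V = VecP.lookup⇒[]= _ _ (trans (sym (U↦V x)) (VecP.[]=⇒lookup σx∈V))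

  ↦-σ⁻¹ : ∀ {U V y} → U ↦ V → y ∈ V → σ⁻¹ y ∈ U
  ↦-σ⁻¹ {V = V} {y} U↦V y∈V = ↦-∈⁻ U↦V (subst (_∈ V) (sym (σσ⁻¹ y)) y∈V)

  ↦-⊤ : ⊤ ↦ ⊤
  ↦-⊤ = image λ i → lookup-≡ {p = ⊤} {⊤} {σ· i} {i} (λ _ → SubsetP.∈⊤) (λ _ → SubsetP.∈⊤)

  ↦-─ : ∀ {U V W W′} → U ↦ V → W ↦ W′ → U ─ W ↦ V ─ W′
  ↦-─ {U} {V} {W} {W′} (image U↦V) (image W↦W′) =
    image λ i → lookup-zipWith-cong _ {V} {U} {W′} {W} {σ· i} {i} (U↦V i) (W↦W′ i)

  σ-injective : ∀ {x y} → σ· x ≡ σ· y → x ≡ y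
  σ-injective {x} {y} σx≡σy =
    trans (sym (inverseˡ perm)) (trans (cong σ⁻¹ σx≡σy) (inverseˡ perm))

  ↦-⁅⁆ : ∀ x → ⁅ x ⁆ ↦ ⁅ σ· x ⁆
  ↦-⁅⁆ x = image λ i → lookup-≡ {p = ⁅ σ· x ⁆} {⁅ x ⁆} {σ· i} {i}
    (λ σi∈ → ∈-singleton (σ-injective (SubsetP.x∈⁅y⁆⇒x≡y _ σi∈)))
    (λ i∈ → ∈-singleton (cong σ· (SubsetP.x∈⁅y⁆⇒x≡y _ i∈)))
    where
    ∈-singleton : ∀ {a b : Fin m} → a ≡ b → a ∈ ⁅ b ⁆
    ∈-singleton refl = SubsetP.x∈⁅x⁆ _

  closedNbhd-σ : ∀ x i → lookup (closedNbhd G (σ· x)) (σ· i) ≡ lookup (closedNbhd G x) i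
  closedNbhd-σ x i = begin
    lookup (closedNbhd G (σ· x)) (σ· i)               ≡⟨ VecP.lookup∘tabulate _ (σ· i) ⟩
    ⌊ σ· i Fin.≟ σ· x ⌋ ∨ ⌊ adj? G (σ· x) (σ· i) ⌋   ≡⟨ cong₂ _∨_ same-vertex same-adjacency ⟩
    ⌊ i Fin.≟ x ⌋ ∨ ⌊ adj? G x i ⌋                   ≡⟨ VecP.lookup∘tabulate _ i ⟨
    lookup (closedNbhd G x) i                          ∎
    where
    open ≡-Reasoning
    same-vertex : ⌊ σ· i Fin.≟ σ· x ⌋ ≡ ⌊ i Fin.≟ x ⌋
    same-vertex = ⌊⌋-⇔ (σ· i Fin.≟ σ· x) (i Fin.≟ x) σ-injective (cong σ·)
    same-adjacency : ⌊ adj? G (σ· x) (σ· i) ⌋ ≡ ⌊ adj? G x i ⌋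
    same-adjacency = ⌊⌋-⇔ (adj? G (σ· x) (σ· i)) (adj? G x i) reflects preserves

  ↦-closedNbhd : ∀ x → closedNbhd G x ↦ closedNbhd G (σ· x)
  ↦-closedNbhd x = image (closedNbhd-σ x)

  ↦-card : ∀ {U V} → U ↦ V → ∣ U ∣ ≡ ∣ V ∣
  ↦-card {U} {V} (image U↦V) = ∣∣-permute perm {U} {V} U↦V

  preimage : Subset m → Subset m
  preimage I = tabulate (lookup I ∘ σ·)

  preimage-↦ : ∀ I → preimage I ↦ I
  preimage-↦ I = image λ i → sym (VecP.lookup∘tabulate (lookup I ∘ σ·) i)

  preimage-maximal : ∀ {U V I} → U ↦ V → MaximalIndependent G V I →
                     MaximalIndependent G U (preimage I)
  preimage-maximal {U} {V} {I} U↦V ((I⊆V , I-indep) , I-max) =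
    (I′⊆U , I′-indep) , I′-max
    where
    I′↦I = preimage-↦ I
    I′⊆U : ∀ {x} → x ∈ preimage I → x ∈ U
    I′⊆U x∈I′ = ↦-∈⁻ U↦V (I⊆V (↦-∈ I′↦I x∈I′))
    I′-indep : ∀ x y → x ∈ preimage I → y ∈ preimage I → ¬ Adj G x y
    I′-indep x y x∈I′ y∈I′ = I-indep (σ· x) (σ· y) (↦-∈ I′↦I x∈I′) (↦-∈ I′↦I y∈I′) ∘ preserves
    I′-max : ∀ v → v ∈ U → v ∉ preimage I → ∃[ u ] (u ∈ preimage I × Adj G v u)
    I′-max v v∈U v∉I′ with I-max (σ· v) (↦-∈ U↦V v∈U) (v∉I′ ∘ ↦-∈⁻ I′↦I)
    ... | u , u∈I , σv~u =
      σ⁻¹ u , ↦-σ⁻¹ I′↦I u∈I , reflects (subst (Adj G (σ· v)) (sym (σσ⁻¹ u)) σv~u)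

  ↦-wellCovered : ∀ {U V} → U ↦ V → WellCovered G U → WellCovered G V
  ↦-wellCovered U↦V wc I J I-max J-max = begin
    ∣ I ∣             ≡⟨ ↦-card (preimage-↦ I) ⟨
    ∣ preimage I ∣    ≡⟨ wc _ _ (preimage-maximal U↦V I-max) (preimage-maximal U↦V J-max) ⟩
    ∣ preimage J ∣    ≡⟨ ↦-card (preimage-↦ J) ⟩
    ∣ J ∣             ∎
    where open ≡-Reasoning

  ↦-noEdges : ∀ {U V} → U ↦ V → NoEdges G U → NoEdges G V
  ↦-noEdges U↦V noEdges x y x∈V y∈V x~y =
    noEdges (σ⁻¹ x) (σ⁻¹ y) (↦-σ⁻¹ U↦V x∈V) (↦-σ⁻¹ U↦V y∈V)
      (reflects (subst₂ (Adj G) (sym (σσ⁻¹ x)) (sym (σσ⁻¹ y)) x~y))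

  ↦-vd : ∀ {U V} → U ↦ V → VertexDecomposable G U → VertexDecomposable G V
  ↦-vd U↦V (vd-edgeless wc noEdges) =
    vd-edgeless (↦-wellCovered U↦V wc) (↦-noEdges U↦V noEdges)
  ↦-vd U↦V (vd-shed wc x x∈U deletion link) =
    vd-shed (↦-wellCovered U↦V wc) (σ· x) (↦-∈ U↦V x∈U)
      (↦-vd (↦-─ U↦V (↦-⁅⁆ x)) deletion)
      (↦-vd (↦-─ U↦V (↦-closedNbhd x)) link)

  shed-invariant : ∀ x → InShed G x → InShed G (σ· x)
  shed-invariant x (deletion , link) =
    ↦-vd (↦-─ ↦-⊤ (↦-⁅⁆ x)) deletion , ↦-vd (↦-─ ↦-⊤ (↦-closedNbhd x)) link

-- In an edgeless G[U] the only maximal independent set is U itself, so G[U]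
-- is well-covered and hence vertex decomposable.
noEdges⇒vd : ∀ {m} (G : Graph m) {U : Subset m} → NoEdges G U → VertexDecomposable G U
noEdges⇒vd G {U} noEdges = vd-edgeless well-covered noEdges
  where
  maximal⇒all : ∀ {I} → MaximalIndependent G U I → I ≡ U
  maximal⇒all {I} ((I⊆U , _) , I-max) = SubsetP.⊆-antisym I⊆U U⊆I
    where
    U⊆I : ∀ {v} → v ∈ U → v ∈ I
    U⊆I {v} v∈U with v SubsetP.∈? I
    ... | yes v∈I = v∈I
    ... | no  v∉I = let (u , u∈I , v~u) = I-max v v∈U v∉I
                    in ⊥-elim (noEdges v u v∈U (I⊆U u∈I) v~u)
  well-covered : WellCovered G U
  well-covered I J I-max J-max = cong ∣_∣ (trans (maximal⇒all I-max) (sym (maximal⇒all J-max)))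

noEdges⇒inShed : ∀ {m} (G : Graph m) → NoEdges G ⊤ → ∀ v → InShed G v
noEdges⇒inShed G noEdges v = noEdges⇒vd G noEdges′ , noEdges⇒vd G noEdges′
  where
  noEdges′ : ∀ {U} → NoEdges G U
  noEdges′ x y _ _ = noEdges x y SubsetP.∈⊤ SubsetP.∈⊤

-- The rotation i ↦ i - 1 (mod m + 1) of the vertices of C_{m+1}(S).
rotate : ∀ {m} → Fin (suc m) → Fin (suc m)
rotate {m} fzero = fromℕ m
rotate (fsuc i)  = inject₁ i

rotate⁻¹ : ∀ {m} → Fin (suc m) → Fin (suc m)
rotate⁻¹ {m} i with m ℕ.≟ toℕ i
... | yes _   = fzero
... | no  m≢i = fsuc (lower₁ i m≢i)

rotate∘rotate⁻¹ : ∀ {m} (i : Fin (suc m)) → rotate (rotate⁻¹ i) ≡ i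
rotate∘rotate⁻¹ {m} i with m ℕ.≟ toℕ i
... | yes m≡i = FinP.toℕ-injective (trans (FinP.toℕ-fromℕ m) m≡i)
... | no  m≢i = FinP.inject₁-lower₁ i m≢i

rotate-injective : ∀ {m} {x y : Fin (suc m)} → rotate x ≡ rotate y → x ≡ y
rotate-injective {x = fzero}  {fzero}  _ = refl
rotate-injective {x = fzero}  {fsuc y} e = contradiction e FinP.fromℕ≢inject₁
rotate-injective {x = fsuc x} {fzero}  e = contradiction (sym e) FinP.fromℕ≢inject₁
rotate-injective {x = fsuc x} {fsuc y} e = cong fsuc (FinP.inject₁-injective e)

rotation-perm : ∀ {m} → Permutation (suc m) (suc m)
rotation-perm = permutation rotate rotate⁻¹ rotate∘rotate⁻¹
                  (λ x → rotate-injective (rotate∘rotate⁻¹ (rotate x)))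

-- Circulant adjacency depends only on the distance d, and only up to d ↦ n - d.
CircDistAdj : ℕ → List ℕ → ℕ → Set
CircDistAdj n S d = (d L.∈ S) ⊎ ((n ∸ d) L.∈ S)

SameCircDist : ℕ → ℕ → ℕ → Set
SameCircDist n d d′ = (d ≡ d′) ⊎ ((d′ ≡ n ∸ d) × (d ≡ n ∸ d′))

-- SameCircDist is symmetric, so rotation-invariance of adjacency also gives reflection.
sameCircDist-sym : ∀ {n d d′} → SameCircDist n d d′ → SameCircDist n d′ d
sameCircDist-sym (inj₁ d≡d′)        = inj₁ (sym d≡d′)
sameCircDist-sym (inj₂ (e₁ , e₂)) = inj₂ (e₂ , e₁)

circDistAdj-cong : ∀ n S {d d′} → SameCircDist n d d′ → CircDistAdj n S d → CircDistAdj n S d′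
circDistAdj-cong n S (inj₁ refl)       adj       = adj
circDistAdj-cong n S (inj₂ (_ , d≡)) (inj₁ d∈S) = inj₂ (subst (L._∈ S) d≡ d∈S)
circDistAdj-cong n S (inj₂ (d′≡ , _)) (inj₂ n∸d∈S) = inj₁ (subst (L._∈ S) (sym d′≡) n∸d∈S)

-- Rotating moves the top vertex m next to 0: the distance between 0 and j + 1
-- becomes the distance between m and j, which is complementary.
dist-top : ∀ {m} (j : Fin m) → SameCircDist (suc m) (suc (toℕ j)) ∣ m - toℕ j ∣
dist-top {m} j = inj₂ (top-j , sym (trans (cong (suc m ∸_) top-j) complement))
  where
  j≤m = ℕP.<⇒≤ (FinP.toℕ<n j)
  top-j : ∣ m - toℕ j ∣ ≡ m ∸ toℕ j
  top-j = ℕP.m≤n⇒∣n-m∣≡n∸m j≤m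
  complement : suc m ∸ (m ∸ toℕ j) ≡ suc (toℕ j)
  complement = trans (ℕP.+-∸-assoc 1 (ℕP.m∸n≤m m (toℕ j))) (cong suc (ℕP.m∸[m∸n]≡n j≤m))

dist-rotate : ∀ {m} (a b : Fin (suc m)) → SameCircDist (suc m) (dist a b) (dist (rotate a) (rotate b))
dist-rotate {m} fzero    fzero    = inj₁ (sym (ℕP.∣n-n∣≡0 (toℕ (fromℕ m))))
dist-rotate {m} (fsuc i) (fsuc j) =
  inj₁ (sym (cong₂ ∣_-_∣ (FinP.toℕ-inject₁ i) (FinP.toℕ-inject₁ j)))
dist-rotate {m} fzero    (fsuc j)
  rewrite FinP.toℕ-fromℕ m | FinP.toℕ-inject₁ j = dist-top j
dist-rotate {m} (fsuc j) fzero
  rewrite FinP.toℕ-fromℕ m | FinP.toℕ-inject₁ j | ℕP.∣-∣-comm (toℕ j) m = dist-top j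

rotation : ∀ m S → Automorphism (Circulant (suc m) S)
rotation m S = record
  { perm      = rotation-perm
  ; preserves = λ {a} {b} → circDistAdj-cong (suc m) S (dist-rotate a b)
  ; reflects  = λ {a} {b} → circDistAdj-cong (suc m) S (sameCircDist-sym (dist-rotate a b))
  }

-- A property of vertices preserved by the rotation holds everywhere once it
-- holds somewhere: walk down from x to 0, rotate 0 to the top vertex m, and
-- walk down from m to any v (the orbit of the rotation is all of Fin (m + 1)).
rotation-closed⇒everywhere : ∀ {m} (P : Fin (suc m) → Set) →
                             (∀ x → P x → P (rotate x)) → ∀ x → P x → ∀ v → P v
rotation-closed⇒everywhere {m} P closed x Px =
  >-weakInduction P (closed fzero P₀) (λ i → closed (fsuc i))
  where
  P₀ : P fzero
  P₀ = <-weakInduction (λ i → P i → P fzero) id (λ i down → down ∘ closed (fsuc i)) x Px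

theorem2p10 : (n : ℕ) → 1 ≤ n → (S : List ℕ) → ValidConnSet n S
    → VertexDecomposable (Circulant n S) ⊤
    → Dominating (Circulant n S) (InShed (Circulant n S))
theorem2p10 (suc m) _ S _ vd v v∉Shed = contradiction (every-vertex-sheds vd v) v∉Shed
  where
  G = Circulant (suc m) S
  every-vertex-sheds : VertexDecomposable G ⊤ → ∀ v → InShed G v
  every-vertex-sheds (vd-edgeless _ noEdges) = noEdges⇒inShed G noEdges
  every-vertex-sheds (vd-shed _ x _ deletion link) =
    rotation-closed⇒everywhere (InShed G)
      (AutomorphismAction.shed-invariant (rotation m S)) x (deletion , link)
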